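{- Let $S$ be a finite set with $n=|S|$ and let $C=\{C_1,\dots,C_k\}$ and $C'=\{C'_1,\dots,C'_k\}$ be two $k$-clusterings of $S$. If $\mathrm{dist}(C,C')=d$, then $F(C,C')\ge1-3d/2$.
   Context: A $k$-clustering of $S$ is a partition of $S$ into $k$ sets. $\mathrm{dist}(C,C')=\min_\sigma\frac1n\sum_{i=1}^k|C_i\setminus C'_{\sigma(i)}|$, the minimum over bijections $\sigma$ of $\{1,\dots,k\}$. For clusters $C_i\in C$, $C'_j\in C'$ let $\mathrm{pr}(C_i,C'_j)=\frac{2|C_i\cap C'_j|}{|C_i|+|C'_j|}$ (the harmonic mean of precision $|C_i\cap C'_j|/|C_i|$ and recall $|C_i\cap C'_j|/|C'_j|$). The F-measure is $F(C,C')=\frac1n\sum_{C_i\in C}|C_i|\max_{C'_j\in C'}\mathrm{pr}(C_i,C'_j)$. -}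

module Defs where

open import Data.Nat as ℕ using (ℕ; zero; suc)
open import Data.Fin using (Fin; zero; suc; _≟_)
open import Data.Fin.Permutation using (Permutation′; _⟨$⟩ʳ_)
open import Data.Integer using (+_)
open import Data.Rational using (ℚ; 0ℚ; _/_; _+_; _*_; _⊔_; _≤_)
open import Data.Bool using (Bool; true; false; if_then_else_; not)
open import Data.Product using (∃; _×_)
open import Relation.Nullary using (does)
open import Relation.Binary.PropositionalEquality using (_≡_)

-- A k-clustering of S = Fin n: a labelling x ↦ index of the cluster containing x,
-- surjective so that every cluster C_i = { x | c x ≡ i } is nonempty (a partition).
Labelling : ℕ → ℕ → Set
Labelling n k = Fin n → Fin k

IsClustering : ∀ {n k} → Labelling n k → Set
IsClustering {n} {k} c = ∀ (i : Fin k) → ∃ λ (x : Fin n) → c x ≡ i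

sumℕ : ∀ {m} → (Fin m → ℕ) → ℕ
sumℕ {zero} f = 0
sumℕ {suc m} f = f zero ℕ.+ sumℕ (λ i → f (suc i))

sumℚ : ∀ {m} → (Fin m → ℚ) → ℚ
sumℚ {zero} f = 0ℚ
sumℚ {suc m} f = f zero + sumℚ (λ i → f (suc i))

-- maximum over Fin m (pr-values are ≥ 0, so base 0 is harmless; k ≥ 1 here anyway)
maxℚ : ∀ {m} → (Fin m → ℚ) → ℚ
maxℚ {zero} f = 0ℚ
maxℚ {suc m} f = f zero ⊔ maxℚ (λ i → f (suc i))

count : ∀ {n} → (Fin n → Bool) → ℕ
count p = sumℕ (λ x → if p x then 1 else 0)

size : ∀ {n k} → Labelling n k → Fin k → ℕ
size c i = count (λ x → does (c x ≟ i))

inter : ∀ {n k} → Labelling n k → Labelling n k → Fin k → Fin k → ℕ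
inter c c' i j = count (λ x → Data.Bool._∧_ (does (c x ≟ i)) (does (c' x ≟ j)))

diff : ∀ {n k} → Labelling n k → Labelling n k → Fin k → Fin k → ℕ
diff c c' i j = count (λ x → Data.Bool._∧_ (does (c x ≟ i)) (not (does (c' x ≟ j))))

-- a / b as a rational, with the (never used for clusterings) convention a / 0 = 0
frac : ℕ → ℕ → ℚ
frac a zero = 0ℚ
frac a (suc b) = (+ a) / suc b

cost : ∀ {n k} → Labelling n k → Labelling n k → Permutation′ k → ℚ
cost {n} c c' σ = frac (sumℕ (λ i → diff c c' i (σ ⟨$⟩ʳ i))) n

IsDist : ∀ {n k} → Labelling n k → Labelling n k → ℚ → Set
IsDist {n} {k} c c' d =
  (∃ λ (σ : Permutation′ k) → cost c c' σ ≡ d) × (∀ (σ : Permutation′ k) → d ≤ cost c c' σ)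

pr : ∀ {n k} → Labelling n k → Labelling n k → Fin k → Fin k → ℚ
pr c c' i j = frac (2 ℕ.* inter c c' i j) (size c i ℕ.+ size c' j)

Fmeasure : ∀ {n k} → Labelling n k → Labelling n k → ℚ
Fmeasure {n} c c' =
  (frac 1 n) * sumℚ (λ i → frac (size c i) 1 * maxℚ (λ j → pr c c' i j))

-- Let σ be a bijection attaining d and, for each cluster i, put
--   x = |C_i ∩ C'_σi|,  e = |C_i \ C'_σi|,  f = |C'_σi \ C_i|,
-- so |C_i| = x + e and |C'_σi| = x + f.  The whole argument rests on the
-- elementary bound (harmonic-bound)
--   (x + e) · 2x / ((x + e) + (x + f))  ≥  x - f/2,
-- whose slack is (xe + ef/2 + f²/2) / (2x + e + f) ≥ 0.  Writing X, E, F
-- for the sums of x, e, f over i, counting gives X + E = n = X + F (both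
-- clusterings partition S and σ is a bijection), so F = E = n·d, and
--   n · F(C,C') ≥ Σ_i |C_i| pr(C_i, C'_σi) ≥ X - F/2 = n - 3E/2.
module Submission where

open import Defs
open import Data.Nat as ℕ using (ℕ; zero; suc; _<_)
import Data.Nat.Properties as ℕ
import Data.Nat.Solver as ℕSolver
open import Data.Integer as ℤ using (+_)
import Data.Integer.Properties as ℤ
import Data.Integer.Solver as ℤSolver
open import Data.Rational as ℚ using (ℚ; 0ℚ; 1ℚ; _/_; _+_; _*_; _-_; _≤_; toℚᵘ)
open import Data.Rational.Properties hiding (_≟_)
import Data.Rational.Solver as ℚSolver
import Data.Rational.Unnormalised as ℚᵘ
import Data.Rational.Unnormalised.Properties as ℚᵘ
open import Data.Fin as Fin using (Fin; _≟_)
open import Data.Fin.Permutation as Perm using (Permutation′; _⟨$⟩ʳ_; _⟨$⟩ˡ_; inverseʳ; inverseˡ)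
open import Data.Bool using (Bool; true; false; if_then_else_; not; _∧_)
open import Data.Bool.Properties using (∧-comm)
open import Data.Product using (_,_)
open import Relation.Nullary using (does; yes; no; contradiction)
open import Relation.Binary.PropositionalEquality

ι : ℕ → ℚ
ι m = frac m 1

½ : ℚ
½ = frac 1 2

frac-toℚᵘ : ∀ a m → toℚᵘ (frac a (suc m)) ℚᵘ.≃ ℚᵘ.mkℚᵘ (+ a) m
frac-toℚᵘ a m = toℚᵘ-fromℚᵘ (ℚᵘ.mkℚᵘ (+ a) m)

module _ where
  open ℤSolver.+-*-Solver
  open ℚᵘ.≃-Reasoning

  ι-+ : ∀ a b → ι (a ℕ.+ b) ≡ ι a + ι b
  ι-+ a b = toℚᵘ-injective (begin
    toℚᵘ (ι (a ℕ.+ b))                    ≈⟨ frac-toℚᵘ (a ℕ.+ b) 0 ⟩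
    ℚᵘ.mkℚᵘ (+ a ℤ.+ + b) 0               ≈⟨ ℚᵘ.*≡* (solve 2 (λ x y → (x :+ y) :* con (+ 1) := (x :* con (+ 1) :+ y :* con (+ 1)) :* con (+ 1)) refl (+ a) (+ b)) ⟩
    ℚᵘ.mkℚᵘ (+ a) 0 ℚᵘ.+ ℚᵘ.mkℚᵘ (+ b) 0  ≈⟨ ℚᵘ.≃-sym (ℚᵘ.+-cong (frac-toℚᵘ a 0) (frac-toℚᵘ b 0)) ⟩
    toℚᵘ (ι a) ℚᵘ.+ toℚᵘ (ι b)            ≈⟨ ℚᵘ.≃-sym (toℚᵘ-homo-+ (ι a) (ι b)) ⟩
    toℚᵘ (ι a + ι b)                      ∎)

  ι-* : ∀ a b → ι (a ℕ.* b) ≡ ι a * ι b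
  ι-* a b = toℚᵘ-injective (begin
    toℚᵘ (ι (a ℕ.* b))                    ≈⟨ frac-toℚᵘ (a ℕ.* b) 0 ⟩
    ℚᵘ.mkℚᵘ (+ (a ℕ.* b)) 0               ≈⟨ ℚᵘ.*≡* (trans (cong (ℤ._* + 1) (ℤ.pos-* a b)) (solve 2 (λ x y → (x :* y) :* con (+ 1) := (x :* y) :* con (+ 1)) refl (+ a) (+ b))) ⟩
    ℚᵘ.mkℚᵘ (+ a) 0 ℚᵘ.* ℚᵘ.mkℚᵘ (+ b) 0  ≈⟨ ℚᵘ.≃-sym (ℚᵘ.*-cong (frac-toℚᵘ a 0) (frac-toℚᵘ b 0)) ⟩
    toℚᵘ (ι a) ℚᵘ.* toℚᵘ (ι b)            ≈⟨ ℚᵘ.≃-sym (toℚᵘ-homo-* (ι a) (ι b)) ⟩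
    toℚᵘ (ι a * ι b)                      ∎)

  frac-split : ∀ a m → frac a (suc m) ≡ ι a * frac 1 (suc m)
  frac-split a m = toℚᵘ-injective (begin
    toℚᵘ (frac a (suc m))                       ≈⟨ frac-toℚᵘ a m ⟩
    ℚᵘ.mkℚᵘ (+ a) m                             ≈⟨ ℚᵘ.*≡* (solve 2 (λ x y → x :* (con (+ 1) :* y) := (x :* con (+ 1)) :* y) refl (+ a) (+ suc m)) ⟩
    ℚᵘ.mkℚᵘ (+ a) 0 ℚᵘ.* ℚᵘ.mkℚᵘ (+ 1) m        ≈⟨ ℚᵘ.≃-sym (ℚᵘ.*-cong (frac-toℚᵘ a 0) (frac-toℚᵘ 1 m)) ⟩
    toℚᵘ (ι a) ℚᵘ.* toℚᵘ (frac 1 (suc m))       ≈⟨ ℚᵘ.≃-sym (toℚᵘ-homo-* (ι a) (frac 1 (suc m))) ⟩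
    toℚᵘ (ι a * frac 1 (suc m))                 ∎)

  frac-inverse : ∀ m → frac 1 (suc m) * ι (suc m) ≡ 1ℚ
  frac-inverse m = toℚᵘ-injective (begin
    toℚᵘ (frac 1 (suc m) * ι (suc m))               ≈⟨ toℚᵘ-homo-* (frac 1 (suc m)) (ι (suc m)) ⟩
    toℚᵘ (frac 1 (suc m)) ℚᵘ.* toℚᵘ (ι (suc m))     ≈⟨ ℚᵘ.*-cong (frac-toℚᵘ 1 m) (frac-toℚᵘ (suc m) 0) ⟩
    ℚᵘ.mkℚᵘ (+ 1) m ℚᵘ.* ℚᵘ.mkℚᵘ (+ suc m) 0        ≈⟨ ℚᵘ.*≡* (solve 1 (λ y → (con (+ 1) :* y) :* con (+ 1) := con (+ 1) :* (y :* con (+ 1))) refl (+ suc m)) ⟩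
    toℚᵘ 1ℚ                                          ∎)

frac-nonNeg : ∀ a b → 0ℚ ≤ frac a b
frac-nonNeg a zero = ≤-refl
frac-nonNeg a (suc b) = nonNegative⁻¹ (frac a (suc b)) {{normalize-nonNeg a (suc b)}}

+-nonNeg : ∀ {p q} → 0ℚ ≤ p → 0ℚ ≤ q → 0ℚ ≤ p + q
+-nonNeg {p} {q} 0≤p 0≤q = subst (_≤ p + q) (+-identityˡ 0ℚ) (+-mono-≤ 0≤p 0≤q)

*-nonNeg : ∀ {p q} → 0ℚ ≤ p → 0ℚ ≤ q → 0ℚ ≤ p * q
*-nonNeg {p} {q} 0≤p 0≤q =
  nonNegative⁻¹ (p * q) {{nonNeg*nonNeg⇒nonNeg p {{ℚ.nonNegative 0≤p}} q {{ℚ.nonNegative 0≤q}}}}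

≤-+-nonNeg : ∀ p {q} → 0ℚ ≤ q → p ≤ p + q
≤-+-nonNeg p {q} 0≤q = subst (_≤ p + q) (+-identityʳ p) (+-monoʳ-≤ p 0≤q)

-- For a cluster of size x + e matched with one of size x + f sharing x
-- points, its weighted pr-value is at least x - f/2.  The difference of the
-- two sides is (xe + ef/2 + f²/2) / (2x + e + f), hence nonnegative; this
-- is the computation when the denominator 2x + e + f = suc m is nonzero.
harmonic-bound-pos : ∀ x e f m → suc m ≡ (x ℕ.+ e) ℕ.+ (x ℕ.+ f) →
                     ι x - ½ * ι f ≤ ι (x ℕ.+ e) * frac (2 ℕ.* x) (suc m)
harmonic-bound-pos x e f m s≡ = begin
  X - ½ * F
    ≡⟨ sym (trans (cong ((X - ½ * F) *_) U·S≡1) (*-identityʳ _)) ⟩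
  (X - ½ * F) * (U * ((X + E) + (X + F)))
    ≤⟨ ≤-+-nonNeg _ slack-nonNeg ⟩
  (X - ½ * F) * (U * ((X + E) + (X + F))) + slack
    ≡⟨ solve 4 (λ X E F U → (X :- con ½ :* F) :* (U :* ((X :+ E) :+ (X :+ F)))
                              :+ U :* ((X :* E :+ con ½ :* E :* F) :+ con ½ :* F :* F)
                            := (X :+ E) :* ((con (ι 2) :* X) :* U)) refl X E F U ⟩
  (X + E) * ((ι 2 * X) * U)
    ≡⟨ sym (cong₂ _*_ (ι-+ x e) (trans (frac-split (2 ℕ.* x) m) (cong (_* U) (ι-* 2 x)))) ⟩
  ι (x ℕ.+ e) * frac (2 ℕ.* x) (suc m) ∎
  where
  open ≤-Reasoning
  open ℚSolver.+-*-Solver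
  X E F U slack : ℚ
  X = ι x
  E = ι e
  F = ι f
  U = frac 1 (suc m)
  slack = U * ((X * E + ½ * E * F) + ½ * F * F)

  U·S≡1 : U * ((X + E) + (X + F)) ≡ 1ℚ
  U·S≡1 = begin-equality
    U * ((X + E) + (X + F))         ≡⟨ cong (U *_) (sym (trans (ι-+ (x ℕ.+ e) (x ℕ.+ f)) (cong₂ _+_ (ι-+ x e) (ι-+ x f)))) ⟩
    U * ι ((x ℕ.+ e) ℕ.+ (x ℕ.+ f)) ≡⟨ cong (λ s → U * ι s) (sym s≡) ⟩
    U * ι (suc m)                   ≡⟨ frac-inverse m ⟩
    1ℚ                              ∎

  slack-nonNeg : 0ℚ ≤ slack
  slack-nonNeg = *-nonNeg (frac-nonNeg 1 (suc m))
    (+-nonNeg (+-nonNeg (*-nonNeg (frac-nonNeg x 1) (frac-nonNeg e 1))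
                        (*-nonNeg (*-nonNeg (frac-nonNeg 1 2) (frac-nonNeg e 1)) (frac-nonNeg f 1)))
              (*-nonNeg (*-nonNeg (frac-nonNeg 1 2) (frac-nonNeg f 1)) (frac-nonNeg f 1)))

-- The bound for all x, e, f: when x = e = f = 0 both sides are 0, and
-- otherwise the denominator is visibly a successor.
harmonic-bound : ∀ x e f → ι x - ½ * ι f ≤ ι (x ℕ.+ e) * frac (2 ℕ.* x) ((x ℕ.+ e) ℕ.+ (x ℕ.+ f))
harmonic-bound zero    zero    zero    = ≤-refl
harmonic-bound zero    zero    (suc f) = harmonic-bound-pos 0 0 (suc f) f refl
harmonic-bound zero    (suc e) f       = harmonic-bound-pos 0 (suc e) f _ refl
harmonic-bound (suc x) e       f       = harmonic-bound-pos (suc x) e f _ refl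

sumℕ-cong : ∀ {k} {f g : Fin k → ℕ} → (∀ i → f i ≡ g i) → sumℕ f ≡ sumℕ g
sumℕ-cong {zero}  f≡g = refl
sumℕ-cong {suc k} f≡g = cong₂ ℕ._+_ (f≡g Fin.zero) (sumℕ-cong (λ i → f≡g (Fin.suc i)))

sumℕ-+ : ∀ {k} (f g : Fin k → ℕ) → sumℕ (λ i → f i ℕ.+ g i) ≡ sumℕ f ℕ.+ sumℕ g
sumℕ-+ {zero}  f g = refl
sumℕ-+ {suc k} f g = begin
  (f₀ ℕ.+ g₀) ℕ.+ sumℕ (λ i → f (Fin.suc i) ℕ.+ g (Fin.suc i))
    ≡⟨ cong ((f₀ ℕ.+ g₀) ℕ.+_) (sumℕ-+ (λ i → f (Fin.suc i)) (λ i → g (Fin.suc i))) ⟩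
  (f₀ ℕ.+ g₀) ℕ.+ (sumℕ (λ i → f (Fin.suc i)) ℕ.+ sumℕ (λ i → g (Fin.suc i)))
    ≡⟨ solve 4 (λ a b c d → (a :+ b) :+ (c :+ d) := (a :+ c) :+ (b :+ d)) refl
               f₀ g₀ (sumℕ (λ i → f (Fin.suc i))) (sumℕ (λ i → g (Fin.suc i))) ⟩
  (f₀ ℕ.+ sumℕ (λ i → f (Fin.suc i))) ℕ.+ (g₀ ℕ.+ sumℕ (λ i → g (Fin.suc i))) ∎
  where
  open ≡-Reasoning
  open ℕSolver.+-*-Solver
  f₀ g₀ : ℕ
  f₀ = f Fin.zero
  g₀ = g Fin.zero

sumℕ-const : ∀ {k} c → sumℕ {k} (λ _ → c) ≡ k ℕ.* c
sumℕ-const {zero}  c = refl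
sumℕ-const {suc k} c = cong (c ℕ.+_) (sumℕ-const {k} c)

sumℕ-swap : ∀ {k n} (g : Fin k → Fin n → ℕ) →
            sumℕ (λ i → sumℕ (λ x → g i x)) ≡ sumℕ (λ x → sumℕ (λ i → g i x))
sumℕ-swap {zero}  {n} g = sym (trans (sumℕ-const {n} 0) (ℕ.*-zeroʳ n))
sumℕ-swap {suc k}     g = trans (cong (sumℕ (g Fin.zero) ℕ.+_) (sumℕ-swap (λ i → g (Fin.suc i))))
                                (sym (sumℕ-+ (g Fin.zero) (λ x → sumℕ (λ i → g (Fin.suc i) x))))

⟦_⟧ : Bool → ℕ
⟦ b ⟧ = if b then 1 else 0

indicator-sum : ∀ {k} (j : Fin k) → sumℕ (λ i → ⟦ does (j ≟ i) ⟧) ≡ 1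
indicator-sum {suc k} Fin.zero    = cong suc (trans (sumℕ-const {k} 0) (ℕ.*-zeroʳ k))
indicator-sum         (Fin.suc j) = indicator-sum j

indicator-sum-perm : ∀ {k} (σ : Permutation′ k) (a : Fin k) → sumℕ (λ i → ⟦ does (a ≟ σ ⟨$⟩ʳ i) ⟧) ≡ 1
indicator-sum-perm σ a = trans (sumℕ-cong (λ i → cong ⟦_⟧ (same-test i))) (indicator-sum (σ ⟨$⟩ˡ a))
  where
  same-test : ∀ i → does (a ≟ σ ⟨$⟩ʳ i) ≡ does (σ ⟨$⟩ˡ a ≟ i)
  same-test i with a ≟ σ ⟨$⟩ʳ i | σ ⟨$⟩ˡ a ≟ i
  ... | yes _    | yes _    = refl
  ... | no _     | no _     = refl
  ... | yes a≡σi | no σ⁻a≢i = contradiction (trans (cong (σ ⟨$⟩ˡ_) a≡σi) (inverseˡ σ)) σ⁻a≢i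
  ... | no a≢σi  | yes σ⁻a≡i = contradiction (trans (sym (inverseʳ σ)) (cong (σ ⟨$⟩ʳ_) σ⁻a≡i)) a≢σi

count-cong : ∀ {n} {p q : Fin n → Bool} → (∀ x → p x ≡ q x) → count p ≡ count q
count-cong p≡q = sumℕ-cong (λ x → cong ⟦_⟧ (p≡q x))

count-split : ∀ {n} (p q : Fin n → Bool) →
              count p ≡ count (λ x → p x ∧ q x) ℕ.+ count (λ x → p x ∧ not (q x))
count-split p q = trans (sumℕ-cong (λ x → split (p x) (q x)))
                        (sumℕ-+ (λ x → ⟦ p x ∧ q x ⟧) (λ x → ⟦ p x ∧ not (q x) ⟧))
  where
  split : ∀ a b → ⟦ a ⟧ ≡ ⟦ a ∧ b ⟧ ℕ.+ ⟦ a ∧ not b ⟧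
  split true  true  = refl
  split true  false = refl
  split false b     = refl

size-split : ∀ {n k} (c c' : Labelling n k) i j → size c i ≡ inter c c' i j ℕ.+ diff c c' i j
size-split c c' i j = count-split (λ x → does (c x ≟ i)) (λ x → does (c' x ≟ j))

inter-sym : ∀ {n k} (c c' : Labelling n k) i j → inter c' c j i ≡ inter c c' i j
inter-sym c c' i j = count-cong (λ x → ∧-comm (does (c' x ≟ j)) (does (c x ≟ i)))

size-split′ : ∀ {n k} (c c' : Labelling n k) i j → size c' j ≡ inter c c' i j ℕ.+ diff c' c j i
size-split′ c c' i j = trans (size-split c' c j i) (cong (ℕ._+ diff c' c j i) (inter-sym c c' i j))

sizes-sum : ∀ {n k} (c : Labelling n k) (σ : Permutation′ k) → sumℕ (λ i → size c (σ ⟨$⟩ʳ i)) ≡ n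
sizes-sum {n} c σ = begin
  sumℕ (λ i → sumℕ (λ x → ⟦ does (c x ≟ σ ⟨$⟩ʳ i) ⟧)) ≡⟨ sumℕ-swap (λ i x → ⟦ does (c x ≟ σ ⟨$⟩ʳ i) ⟧) ⟩
  sumℕ (λ x → sumℕ (λ i → ⟦ does (c x ≟ σ ⟨$⟩ʳ i) ⟧)) ≡⟨ sumℕ-cong (λ x → indicator-sum-perm σ (c x)) ⟩
  sumℕ {n} (λ _ → 1)                                   ≡⟨ sumℕ-const {n} 1 ⟩
  n ℕ.* 1                                              ≡⟨ ℕ.*-identityʳ n ⟩
  n                                                    ∎
  where open ≡-Reasoning

sumℚ-mono : ∀ {k} {f g : Fin k → ℚ} → (∀ i → f i ≤ g i) → sumℚ f ≤ sumℚ g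
sumℚ-mono {zero}  f≤g = ≤-refl
sumℚ-mono {suc k} f≤g = +-mono-≤ (f≤g Fin.zero) (sumℚ-mono (λ i → f≤g (Fin.suc i)))

sumℚ-affine : ∀ {k} (a : ℚ) (x f : Fin k → ℕ) →
              sumℚ (λ i → ι (x i) - a * ι (f i)) ≡ ι (sumℕ x) - a * ι (sumℕ f)
sumℚ-affine {zero}  a x f = solve 1 (λ a → con 0ℚ := con 0ℚ :- a :* con 0ℚ) refl a
  where open ℚSolver.+-*-Solver
sumℚ-affine {suc k} a x f = begin
  (ι x₀ - a * ι f₀) + sumℚ (λ i → ι (x (Fin.suc i)) - a * ι (f (Fin.suc i)))
    ≡⟨ cong (_+_ (ι x₀ - a * ι f₀)) (sumℚ-affine a (λ i → x (Fin.suc i)) (λ i → f (Fin.suc i))) ⟩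
  (ι x₀ - a * ι f₀) + (ι Σx - a * ι Σf)
    ≡⟨ solve 5 (λ a x₀ f₀ Σx Σf → (x₀ :- a :* f₀) :+ (Σx :- a :* Σf) := (x₀ :+ Σx) :- a :* (f₀ :+ Σf))
               refl a (ι x₀) (ι f₀) (ι Σx) (ι Σf) ⟩
  (ι x₀ + ι Σx) - a * (ι f₀ + ι Σf)
    ≡⟨ sym (cong₂ (λ u v → u - a * v) (ι-+ x₀ Σx) (ι-+ f₀ Σf)) ⟩
  ι (x₀ ℕ.+ Σx) - a * ι (f₀ ℕ.+ Σf) ∎
  where
  open ≡-Reasoning
  open ℚSolver.+-*-Solver
  x₀ f₀ Σx Σf : ℕ
  x₀ = x Fin.zero
  f₀ = f Fin.zero
  Σx = sumℕ (λ i → x (Fin.suc i))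
  Σf = sumℕ (λ i → f (Fin.suc i))

maxℚ-upper : ∀ {k} (f : Fin k → ℚ) j → f j ≤ maxℚ f
maxℚ-upper f Fin.zero    = p≤p⊔q (f Fin.zero) _
maxℚ-upper f (Fin.suc j) = p≤q⇒p≤r⊔q (f Fin.zero) (maxℚ-upper (λ i → f (Fin.suc i)) j)

cluster-bound : ∀ {n k} (c c' : Labelling n k) i j →
                ι (inter c c' i j) - ½ * ι (diff c' c j i) ≤ ι (size c i) * maxℚ (pr c c' i)
cluster-bound c c' i j = ≤-trans matched-bound
  (*-monoˡ-≤-nonNeg (ι (size c i)) {{normalize-nonNeg (size c i) 1}} (maxℚ-upper (pr c c' i) j))
  where
  x : ℕ
  x = inter c c' i j

  matched-bound : ι x - ½ * ι (diff c' c j i) ≤ ι (size c i) * pr c c' i j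
  matched-bound = subst₂ (λ a b → ι x - ½ * ι (diff c' c j i) ≤ ι a * frac (2 ℕ.* x) (a ℕ.+ b))
                         (sym (size-split c c' i j)) (sym (size-split′ c c' i j))
                         (harmonic-bound x (diff c c' i j) (diff c' c j i))

target-rewrite : ∀ m X E → X ℕ.+ E ≡ suc m →
                 1ℚ - (+ 3 / 2) * frac E (suc m) ≡ frac 1 (suc m) * (ι X - ½ * ι E)
target-rewrite m X E X+E≡n = begin
  1ℚ - (+ 3 / 2) * frac E (suc m)
    ≡⟨ cong₂ (λ u v → u - (+ 3 / 2) * v) one≡U·[X+E] (frac-split E m) ⟩
  U * (ι X + ι E) - (+ 3 / 2) * (ι E * U)
    ≡⟨ solve 3 (λ U X E → U :* (X :+ E) :- con (+ 3 / 2) :* (E :* U) := U :* (X :- con ½ :* E)) refl U (ι X) (ι E) ⟩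
  U * (ι X - ½ * ι E) ∎
  where
  open ≡-Reasoning
  open ℚSolver.+-*-Solver
  U : ℚ
  U = frac 1 (suc m)
  one≡U·[X+E] : 1ℚ ≡ U * (ι X + ι E)
  one≡U·[X+E] = trans (sym (frac-inverse m)) (cong (U *_) (trans (cong ι (sym X+E≡n)) (ι-+ X E)))

lemma9 : (n k : ℕ) → 0 < n → (c c' : Labelling n k) → IsClustering c → IsClustering c'
    → (d : ℚ) → IsDist c c' d
    → 1ℚ - ((+ 3) / 2) * d ≤ Fmeasure c c'
lemma9 (suc m) k _ c c' _ _ d ((σ , cost≡d) , _) = begin
  1ℚ - (+ 3 / 2) * d                  ≡⟨ cong (λ v → 1ℚ - (+ 3 / 2) * v) (sym cost≡d) ⟩
  1ℚ - (+ 3 / 2) * frac (sumℕ e) n    ≡⟨ target-rewrite m (sumℕ x) (sumℕ e) X+E≡n ⟩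
  U * (ι (sumℕ x) - ½ * ι (sumℕ e))   ≡⟨ cong (λ v → U * (ι (sumℕ x) - ½ * ι v)) (sym F≡E) ⟩
  U * (ι (sumℕ x) - ½ * ι (sumℕ f))   ≡⟨ cong (U *_) (sym (sumℚ-affine ½ x f)) ⟩
  U * sumℚ (λ i → ι (x i) - ½ * ι (f i))
    ≤⟨ *-monoˡ-≤-nonNeg U {{normalize-nonNeg 1 n}} (sumℚ-mono (λ i → cluster-bound c c' i (σ ⟨$⟩ʳ i))) ⟩
  Fmeasure c c' ∎
  where
  open ≤-Reasoning
  n : ℕ
  n = suc m
  U : ℚ
  U = frac 1 n
  x e f : Fin k → ℕ
  x i = inter c c' i (σ ⟨$⟩ʳ i)
  e i = diff c c' i (σ ⟨$⟩ʳ i)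
  f i = diff c' c (σ ⟨$⟩ʳ i) i

  X+E≡n : sumℕ x ℕ.+ sumℕ e ≡ n
  X+E≡n = trans (sym (sumℕ-+ x e)) (trans (sym (sumℕ-cong (λ i → size-split c c' i (σ ⟨$⟩ʳ i)))) (sizes-sum c Perm.id))
  X+F≡n : sumℕ x ℕ.+ sumℕ f ≡ n
  X+F≡n = trans (sym (sumℕ-+ x f)) (trans (sym (sumℕ-cong (λ i → size-split′ c c' i (σ ⟨$⟩ʳ i)))) (sizes-sum c' σ))
  F≡E : sumℕ f ≡ sumℕ e
  F≡E = ℕ.+-cancelˡ-≡ (sumℕ x) (sumℕ f) (sumℕ e) (trans X+F≡n (sym X+E≡n))
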